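{- For all non-negative integers $n$ and $m$, $$\binom{n+m}{n}\sum_{j=0}^n\binom{n}{j}\left(B_{m,j}(x)\,y^{n-j}-\frac{1}{2}E_{m,j}(y)\,x^{n-j}\right)=\frac{1}{2}\sum_{j=0}^{n+m}\binom{n+m}{j}E_{m,j}(y)\,B_{m,n+m-j}(x).$$
   Context: For a non-negative integer $m$, the truncated Euler polynomials $E_{m,n}(x)$ are defined by $$\frac{\frac{2t^m}{m!}e^{xt}}{e^t+1-\sum_{j=0}^{m-1}\frac{t^j}{j!}}=\sum_{n=0}^\infty E_{m,n}(x)\frac{t^n}{n!},$$ and the hypergeometric Bernoulli polynomials $B_{m,n}(x)$ are defined by $$\frac{\frac{t^m}{m!}e^{xt}}{e^t-\sum_{j=0}^{m-1}\frac{t^j}{j!}}=\sum_{n=0}^\infty B_{m,n}(x)\frac{t^n}{n!}$$ (so in particular $B_{0,n}(x)=(x-1)^n$). -}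

module Defs where

open import Data.Nat as ℕ using (ℕ; zero; suc; _!; _<ᵇ_; _≡ᵇ_)
open import Data.Nat.Properties using (_!≢0)
open import Data.Nat.Combinatorics using (_C_)
open import Data.Integer using (+_)
open import Data.Rational using (ℚ; 0ℚ; 1ℚ; _+_; _*_; _-_; _/_; 1/_; ≢-nonZero)
open import Data.Rational.Properties using (_≟_)
open import Data.Bool using (if_then_else_)
open import Data.List using (List; []; _∷_)
open import Relation.Nullary using (yes; no)

ℕ→ℚ : ℕ → ℚ
ℕ→ℚ n = + n / 1

pow : ℚ → ℕ → ℚ
pow x zero    = 1ℚ
pow x (suc k) = x * pow x k

inv! : ℕ → ℚ
inv! k = _/_ (+ 1) (k !) {{k !≢0}}

sumTo : ℕ → (ℕ → ℚ) → ℚ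
sumTo zero    f = f 0
sumTo (suc n) f = sumTo n f + f (suc n)

-- formal power series over ℚ, by ordinary coefficients: s k = [t^k] s
Series : Set
Series = ℕ → ℚ

mulS : Series → Series → Series
mulS a b k = sumTo k (λ i → a i * b (k ℕ.∸ i))

expS : ℚ → Series
expS x k = pow x k * inv! k

truncS : ℕ → Series
truncS m k = if k <ᵇ m then inv! k else 0ℚ

monoS : ℕ → Series
monoS m k = if k ≡ᵇ m then inv! m else 0ℚ

oneS : Series
oneS k = if k ≡ᵇ 0 then 1ℚ else 0ℚ

-- inverse of a rational (0 if it is 0; only used on nonzero values)
invℚ : ℚ → ℚ
invℚ c with c ≟ 0ℚ
... | yes _  = 0ℚ
... | no c≢0 = (1/ c) {{≢-nonZero c≢0}}

-- Quotient N / D of power series, where D has order s (D k = 0 for k < s,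
-- D s ≠ 0) and N k = 0 for k < s.  It is the unique series q with
-- D * q = N, computed by  q k = (N (k+s) - Σ_{i=1}^{k} D (i+s) q (k-i)) / D s.
-- quotList s N D k = [q k, q (k-1), ..., q 0]
quotList : ℕ → Series → Series → ℕ → List ℚ
quotList s N D zero    = (N s * invℚ (D s)) ∷ []
quotList s N D (suc k) = ((N (suc k ℕ.+ s) - conv 1 prev) * invℚ (D s)) ∷ prev
  where
    prev : List ℚ
    prev = quotList s N D k
    conv : ℕ → List ℚ → ℚ
    conv i []       = 0ℚ
    conv i (q ∷ qs) = D (i ℕ.+ s) * q + conv (suc i) qs

headOr0 : List ℚ → ℚ
headOr0 []      = 0ℚ
headOr0 (q ∷ _) = q

quotS : ℕ → Series → Series → Series
quotS s N D k = headOr0 (quotList s N D k)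

-- numerator and denominator of the hypergeometric Bernoulli generating function:
--   (t^m/m!) e^{xt}  /  (e^t - Σ_{j<m} t^j/j!)     (denominator has order m)
numB : ℕ → ℚ → Series
numB m x = mulS (monoS m) (expS x)

denB : ℕ → Series
denB m k = expS 1ℚ k - truncS m k

B : ℕ → ℕ → ℚ → ℚ
B m n x = ℕ→ℚ (n !) * quotS m (numB m x) (denB m) n

-- numerator and denominator of the truncated Euler generating function:
--   (2 t^m/m!) e^{xt}  /  (e^t + 1 - Σ_{j<m} t^j/j!)   (denominator has order 0)
numE : ℕ → ℚ → Series
numE m x k = ℕ→ℚ 2 * mulS (monoS m) (expS x) k

denE : ℕ → Series
denE m k = expS 1ℚ k + oneS k - truncS m k

E : ℕ → ℕ → ℚ → ℚ
E m n x = ℕ→ℚ (n !) * quotS 0 (numE m x) (denE m) n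

{-# OPTIONS --safe #-}
-- Put M = t^m/m! and D = e^t − Σ_{j<m} t^j/j!,
-- and let b = Σ B_{m,j}(x) t^j/j! and h = ½ Σ E_{m,j}(y) t^j/j!, so that
-- D b = M e^{xt} and (D + 1) h = M e^{yt}.  Then
--   D (b e^{yt} − h e^{xt}) = M e^{xt} e^{yt} − (M e^{yt} − h) e^{xt} = h e^{xt},
-- so D · M (b e^{yt} − h e^{xt}) = h · M e^{xt} = D · h b.  As D has order m with a
-- nonzero leading coefficient it can be cancelled:  h b = M (b e^{yt} − h e^{xt}).
-- The coefficient of t^{n+m} on both sides, multiplied by (n+m)!, is the identity.
module Submission where

open import Defs
open import Data.Nat using (ℕ; _∸_) renaming (_+_ to _+ℕ_)
open import Data.Nat.Combinatorics using (_C_)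
open import Data.Rational using (ℚ; _*_; _-_; ½)
open import Relation.Binary.PropositionalEquality using (_≡_)

open import Data.Nat using (zero; suc; _≤_; _<_; z≤n; _!; _<ᵇ_; _≡ᵇ_; NonZero)
import Data.Nat as ℕ
import Data.Nat.Properties as ℕ
open import Data.Nat.Combinatorics using (nCk≡n!/k![n-k]!; k![n∸k]!∣n!)
open import Data.Nat.DivMod using (m/n*n≡m)
open import Data.Nat.Coprimality using (1-coprimeTo) renaming (sym to coprime-sym)
import Data.Integer as ℤ
open import Data.Integer.Properties using (pos-*)
open import Data.Rational using (_+_; 0ℚ; 1ℚ; mkℚ; _/_; ≢-nonZero)
open import Data.Rational.Properties
  using (+-assoc; +-comm; +-identityˡ; +-identityʳ; +-inverseʳ; *-assoc; *-comm;
         *-identityˡ; *-identityʳ; *-zeroˡ; *-zeroʳ; *-distribˡ-+; *-distribʳ-+;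
         *-inverseʳ; normalize-coprime)
  renaming (_≟_ to _≟ℚ_)
open import Data.Rational.Solver using (module +-*-Solver)
open +-*-Solver using (solve; _:+_; _:-_; _:*_; _:=_; con)
open import Data.Bool using (true; false; T)
open import Data.List using (List)
open import Data.Empty using (⊥-elim)
open import Data.Nat.Induction using (<-rec)
open import Relation.Nullary using (¬_; yes; no)
open import Relation.Binary.PropositionalEquality
  using (_≢_; _≗_; refl; sym; trans; cong; cong₂; subst; module ≡-Reasoning; _→-setoid_)
import Relation.Binary.Reasoning.Setoid as SetoidReasoning

sumTo-cong : ∀ n {f g : ℕ → ℚ} → (∀ i → i ≤ n → f i ≡ g i) → sumTo n f ≡ sumTo n g
sumTo-cong zero    f≡g = f≡g 0 z≤n
sumTo-cong (suc n) f≡g =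
  cong₂ _+_ (sumTo-cong n (λ i i≤n → f≡g i (ℕ.m≤n⇒m≤1+n i≤n))) (f≡g (suc n) ℕ.≤-refl)

sumTo-add : ∀ n (f g : ℕ → ℚ) → sumTo n (λ i → f i + g i) ≡ sumTo n f + sumTo n g
sumTo-add zero    f g = refl
sumTo-add (suc n) f g = trans (cong (_+ (f (suc n) + g (suc n))) (sumTo-add n f g))
  (solve 4 (λ a b c d → (a :+ b) :+ (c :+ d) := (a :+ c) :+ (b :+ d)) refl
     (sumTo n f) (sumTo n g) (f (suc n)) (g (suc n)))

sumTo-sub : ∀ n (f g : ℕ → ℚ) → sumTo n (λ i → f i - g i) ≡ sumTo n f - sumTo n g
sumTo-sub zero    f g = refl
sumTo-sub (suc n) f g = trans (cong (_+ (f (suc n) - g (suc n))) (sumTo-sub n f g))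
  (solve 4 (λ a b c d → (a :- b) :+ (c :- d) := (a :+ c) :- (b :+ d)) refl
     (sumTo n f) (sumTo n g) (f (suc n)) (g (suc n)))

*-distribˡ-sumTo : ∀ n c (f : ℕ → ℚ) → c * sumTo n f ≡ sumTo n (λ i → c * f i)
*-distribˡ-sumTo zero    c f = refl
*-distribˡ-sumTo (suc n) c f =
  trans (*-distribˡ-+ c (sumTo n f) (f (suc n))) (cong (_+ c * f (suc n)) (*-distribˡ-sumTo n c f))

*-distribʳ-sumTo : ∀ n c (f : ℕ → ℚ) → sumTo n f * c ≡ sumTo n (λ i → f i * c)
*-distribʳ-sumTo n c f = trans (*-comm (sumTo n f) c)
  (trans (*-distribˡ-sumTo n c f) (sumTo-cong n (λ i _ → *-comm c (f i))))

sumTo-sucˡ : ∀ n (f : ℕ → ℚ) → sumTo (suc n) f ≡ f 0 + sumTo n (λ i → f (suc i))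
sumTo-sucˡ zero    f = refl
sumTo-sucˡ (suc n) f = trans (cong (_+ f (suc (suc n))) (sumTo-sucˡ n f)) (+-assoc (f 0) _ _)

sumTo-zero : ∀ n (f : ℕ → ℚ) → (∀ i → i ≤ n → f i ≡ 0ℚ) → sumTo n f ≡ 0ℚ
sumTo-zero n f f≡0 = trans (sumTo-cong n f≡0) (all-zero n)
  where
  all-zero : ∀ n → sumTo n (λ _ → 0ℚ) ≡ 0ℚ
  all-zero zero    = refl
  all-zero (suc n) = cong (_+ 0ℚ) (all-zero n)

sumTo-single : ∀ n p (f : ℕ → ℚ) → p ≤ n → (∀ i → i ≤ n → i ≢ p → f i ≡ 0ℚ) → sumTo n f ≡ f p
sumTo-single zero    p       f z≤n f≡0 = refl
sumTo-single (suc n) p       f p≤  f≡0 with p ℕ.≟ suc n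
... | yes refl = trans (cong (_+ f (suc n)) (sumTo-zero n f below)) (+-identityˡ _)
  where
  below : ∀ i → i ≤ n → f i ≡ 0ℚ
  below i i≤n = f≡0 i (ℕ.m≤n⇒m≤1+n i≤n) (λ { refl → ℕ.<-irrefl refl (ℕ.s≤s i≤n) })
... | no p≢ = trans
  (cong₂ _+_ (sumTo-single n p f (ℕ.≤-pred (ℕ.≤∧≢⇒< p≤ p≢)) (λ i i≤n → f≡0 i (ℕ.m≤n⇒m≤1+n i≤n)))
             (f≡0 (suc n) ℕ.≤-refl (λ e → p≢ (sym e))))
  (+-identityʳ _)

sumTo-reverse : ∀ n (f : ℕ → ℚ) → sumTo n f ≡ sumTo n (λ i → f (n ∸ i))
sumTo-reverse zero    f = refl
sumTo-reverse (suc n) f = begin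
  sumTo n f + f (suc n)                  ≡⟨ +-comm (sumTo n f) (f (suc n)) ⟩
  f (suc n) + sumTo n f                  ≡⟨ cong (f (suc n) +_) (sumTo-reverse n f) ⟩
  f (suc n) + sumTo n (λ i → f (n ∸ i))  ≡⟨ sumTo-sucˡ n (λ i → f (suc n ∸ i)) ⟨
  sumTo (suc n) (λ i → f (suc n ∸ i))    ∎
  where open ≡-Reasoning

sumTo-triangle : ∀ k (f : ℕ → ℕ → ℚ) →
  sumTo k (λ i → sumTo (k ∸ i) (f i)) ≡ sumTo k (λ s → sumTo s (λ i → f i (s ∸ i)))
sumTo-triangle zero    f = refl
sumTo-triangle (suc k) f = begin
  sumTo k (λ i → sumTo (suc k ∸ i) (f i)) + sumTo (k ∸ k) (f (suc k))
    ≡⟨ cong₂ _+_ (sumTo-cong k (λ i i≤k → cong (λ t → sumTo t (f i)) (ℕ.+-∸-assoc 1 i≤k)))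
                 (cong (λ t → sumTo t (f (suc k))) (ℕ.n∸n≡0 k)) ⟩
  sumTo k (λ i → sumTo (k ∸ i) (f i) + f i (suc (k ∸ i))) + f (suc k) 0
    ≡⟨ cong (_+ f (suc k) 0) (sumTo-add k _ _) ⟩
  (sumTo k (λ i → sumTo (k ∸ i) (f i)) + sumTo k (λ i → f i (suc (k ∸ i)))) + f (suc k) 0
    ≡⟨ +-assoc (sumTo k (λ i → sumTo (k ∸ i) (f i))) _ _ ⟩
  sumTo k (λ i → sumTo (k ∸ i) (f i)) + (sumTo k (λ i → f i (suc (k ∸ i))) + f (suc k) 0)
    ≡⟨ cong₂ _+_ (sumTo-triangle k f)
         (cong₂ _+_ (sumTo-cong k (λ i i≤k → cong (f i) (sym (ℕ.+-∸-assoc 1 i≤k))))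
                    (cong (f (suc k)) (sym (ℕ.n∸n≡0 (suc k))))) ⟩
  sumTo k (λ s → sumTo s (λ i → f i (s ∸ i))) + sumTo (suc k) (λ i → f i (suc k ∸ i))
    ∎
  where open ≡-Reasoning

sumTo-dropZeros : ∀ s t (f : ℕ → ℚ) → (∀ i → i < s → f i ≡ 0ℚ) →
  sumTo (t +ℕ s) f ≡ sumTo t (λ r → f (r +ℕ s))
sumTo-dropZeros s zero    f f≡0 = sumTo-single s s f ℕ.≤-refl (λ i i≤s i≢s → f≡0 i (ℕ.≤∧≢⇒< i≤s i≢s))
sumTo-dropZeros s (suc t) f f≡0 = cong (_+ f (suc (t +ℕ s))) (sumTo-dropZeros s t f f≡0)

addS subS : Series → Series → Series
addS a b k = a k + b k
subS a b k = a k - b k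

scaleS : ℚ → Series → Series
scaleS c a k = c * a k

module ≗-Reasoning = SetoidReasoning (ℕ →-setoid ℚ)

mulS-cong : ∀ {a a′ b b′} → a ≗ a′ → b ≗ b′ → mulS a b ≗ mulS a′ b′
mulS-cong a≗a′ b≗b′ k = sumTo-cong k (λ i _ → cong₂ _*_ (a≗a′ i) (b≗b′ (k ∸ i)))

mulS-congˡ : ∀ {a a′} b → a ≗ a′ → mulS a b ≗ mulS a′ b
mulS-congˡ {a} {a′} b a≗a′ = mulS-cong {a} {a′} {b} {b} a≗a′ (λ _ → refl)

mulS-congʳ : ∀ a {b b′} → b ≗ b′ → mulS a b ≗ mulS a b′
mulS-congʳ a {b} {b′} b≗b′ = mulS-cong {a} {a} {b} {b′} (λ _ → refl) b≗b′

mulS-comm : ∀ a b → mulS a b ≗ mulS b a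
mulS-comm a b k = trans (sumTo-reverse k _) (sumTo-cong k (λ i i≤k →
  trans (cong (a (k ∸ i) *_) (cong b (ℕ.m∸[m∸n]≡n i≤k))) (*-comm (a (k ∸ i)) (b i))))

mulS-assoc : ∀ a b c → mulS (mulS a b) c ≗ mulS a (mulS b c)
mulS-assoc a b c k = sym (begin
  sumTo k (λ i → a i * sumTo (k ∸ i) (λ j → b j * c (k ∸ i ∸ j)))
    ≡⟨ sumTo-cong k (λ i _ → trans (*-distribˡ-sumTo (k ∸ i) (a i) _)
                                   (sumTo-cong (k ∸ i) (λ j _ → sym (*-assoc (a i) (b j) _)))) ⟩
  sumTo k (λ i → sumTo (k ∸ i) (λ j → a i * b j * c (k ∸ i ∸ j)))
    ≡⟨ sumTo-triangle k (λ i j → a i * b j * c (k ∸ i ∸ j)) ⟩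
  sumTo k (λ s → sumTo s (λ i → a i * b (s ∸ i) * c (k ∸ i ∸ (s ∸ i))))
    ≡⟨ sumTo-cong k (λ s _ → sumTo-cong s (λ i i≤s → cong (a i * b (s ∸ i) *_)
         (cong c (trans (ℕ.∸-+-assoc k i (s ∸ i)) (cong (k ∸_) (ℕ.m+[n∸m]≡n i≤s)))))) ⟩
  sumTo k (λ s → sumTo s (λ i → a i * b (s ∸ i) * c (k ∸ s)))
    ≡⟨ sumTo-cong k (λ s _ → sym (*-distribʳ-sumTo s (c (k ∸ s)) _)) ⟩
  sumTo k (λ s → sumTo s (λ i → a i * b (s ∸ i)) * c (k ∸ s))
    ∎)
  where open ≡-Reasoning

mulS-swap : ∀ a b c → mulS a (mulS b c) ≗ mulS b (mulS a c)
mulS-swap a b c = begin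
  mulS a (mulS b c)  ≈⟨ mulS-assoc a b c ⟨
  mulS (mulS a b) c  ≈⟨ mulS-congˡ c (mulS-comm a b) ⟩
  mulS (mulS b a) c  ≈⟨ mulS-assoc b a c ⟩
  mulS b (mulS a c)  ∎
  where open ≗-Reasoning

mulS-distribʳ-addS : ∀ a b c → mulS (addS a b) c ≗ addS (mulS a c) (mulS b c)
mulS-distribʳ-addS a b c k =
  trans (sumTo-cong k (λ i _ → *-distribʳ-+ (c (k ∸ i)) (a i) _)) (sumTo-add k _ _)

mulS-distribˡ-subS : ∀ a b c → mulS a (subS b c) ≗ subS (mulS a b) (mulS a c)
mulS-distribˡ-subS a b c k = trans
  (sumTo-cong k (λ i _ → solve 3 (λ x y z → x :* (y :- z) := x :* y :- x :* z) refl
                           (a i) (b (k ∸ i)) (c (k ∸ i))))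
  (sumTo-sub k _ _)

mulS-distribʳ-subS : ∀ a b c → mulS (subS a b) c ≗ subS (mulS a c) (mulS b c)
mulS-distribʳ-subS a b c k = trans (mulS-comm (subS a b) c k)
  (trans (mulS-distribˡ-subS c a b k) (cong₂ _-_ (mulS-comm c a k) (mulS-comm c b k)))

mulS-scaleˡ : ∀ r a b → mulS (scaleS r a) b ≗ scaleS r (mulS a b)
mulS-scaleˡ r a b k = trans (sumTo-cong k (λ i _ → *-assoc r (a i) _)) (sym (*-distribˡ-sumTo k r _))

mulS-scaleʳ : ∀ r a b → mulS a (scaleS r b) ≗ scaleS r (mulS a b)
mulS-scaleʳ r a b k =
  trans (mulS-comm a (scaleS r b) k) (trans (mulS-scaleˡ r b a k) (cong (r *_) (mulS-comm b a k)))

oneS-off : ∀ j → j ≢ 0 → oneS j ≡ 0ℚ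
oneS-off zero    j≢0 = ⊥-elim (j≢0 refl)
oneS-off (suc j) _   = refl

mulS-identityˡ : ∀ a → mulS oneS a ≗ a
mulS-identityˡ a k = trans
  (sumTo-single k 0 _ z≤n (λ i _ i≢0 → trans (cong (_* a (k ∸ i)) (oneS-off i i≢0)) (*-zeroˡ (a (k ∸ i)))))
  (*-identityˡ (a k))

mulS-single : ∀ a b p → (∀ i → i ≢ p → a i ≡ 0ℚ) → ∀ t → mulS a b (t +ℕ p) ≡ a p * b t
mulS-single a b p a≡0 t = trans
  (sumTo-single (t +ℕ p) p _ (ℕ.m≤n+m p t)
     (λ i _ i≢p → trans (cong (_* b (t +ℕ p ∸ i)) (a≡0 i i≢p)) (*-zeroˡ (b (t +ℕ p ∸ i)))))
  (cong (λ r → a p * b r) (ℕ.m+n∸n≡m t p))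

invℚ-inverseʳ : ∀ c → c ≢ 0ℚ → c * invℚ c ≡ 1ℚ
invℚ-inverseʳ c c≢0 with c ≟ℚ 0ℚ
... | yes c≡0 = ⊥-elim (c≢0 c≡0)
... | no  c≢0 = *-inverseʳ c {{≢-nonZero c≢0}}

*-cancelˡ-≡0 : ∀ c x → c ≢ 0ℚ → c * x ≡ 0ℚ → x ≡ 0ℚ
*-cancelˡ-≡0 c x c≢0 cx≡0 = begin
  x                   ≡⟨ *-identityʳ x ⟨
  x * 1ℚ              ≡⟨ cong (x *_) (invℚ-inverseʳ c c≢0) ⟨
  x * (c * invℚ c)    ≡⟨ solve 3 (λ x c d → x :* (c :* d) := (c :* x) :* d) refl x c (invℚ c) ⟩
  (c * x) * invℚ c    ≡⟨ cong (_* invℚ c) cx≡0 ⟩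
  0ℚ * invℚ c         ≡⟨ *-zeroˡ (invℚ c) ⟩
  0ℚ                  ∎
  where open ≡-Reasoning

-- quotList s N D (suc k) uses a convolution local to its where block, which cannot be
-- named here.  quotConv is that function, solved for by unification in quotS-suc; the
-- with-abstraction turns its arguments into variables, making the problem a pattern.
mutual
  quotConv : ℕ → Series → Series → ℕ → ℕ → List ℚ → ℚ
  quotConv = _

  quotS-suc : ∀ s N D k →
    quotS s N D (suc k) ≡ (N (suc k +ℕ s) - quotConv s N D k 1 (quotList s N D k)) * invℚ (D s)
  quotS-suc s N D k with quotList s N D k | invℚ (D s) | 1
  ... | qs | w | i = refl

quotConv-quotList : ∀ s N D k t i →
  quotConv s N D k i (quotList s N D t) ≡ sumTo t (λ r → D (i +ℕ r +ℕ s) * quotS s N D (t ∸ r))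
quotConv-quotList s N D k zero    i =
  trans (+-identityʳ _) (cong (λ j → D (j +ℕ s) * quotS s N D 0) (sym (ℕ.+-identityʳ i)))
quotConv-quotList s N D k (suc t) i = begin
  D (i +ℕ s) * q (suc t) + quotConv s N D k (suc i) (quotList s N D t)
    ≡⟨ cong₂ _+_ (cong (λ j → D (j +ℕ s) * q (suc t)) (sym (ℕ.+-identityʳ i)))
                 (quotConv-quotList s N D k t (suc i)) ⟩
  D (i +ℕ 0 +ℕ s) * q (suc t) + sumTo t (λ r → D (suc i +ℕ r +ℕ s) * q (t ∸ r))
    ≡⟨ cong (D (i +ℕ 0 +ℕ s) * q (suc t) +_)
         (sumTo-cong t (λ r _ → cong (λ j → D (j +ℕ s) * q (t ∸ r)) (sym (ℕ.+-suc i r)))) ⟩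
  D (i +ℕ 0 +ℕ s) * q (suc t) + sumTo t (λ r → D (i +ℕ suc r +ℕ s) * q (t ∸ r))
    ≡⟨ sumTo-sucˡ t (λ r → D (i +ℕ r +ℕ s) * q (suc t ∸ r)) ⟨
  sumTo (suc t) (λ r → D (i +ℕ r +ℕ s) * q (suc t ∸ r))
    ∎
  where
  open ≡-Reasoning
  q : Series
  q = quotS s N D

record HasOrder (s : ℕ) (D : Series) : Set where
  field
    leading≢0 : D s ≢ 0ℚ
    below≡0   : ∀ i → i < s → D i ≡ 0ℚ

module _ {s : ℕ} {D : Series} (ord : HasOrder s D) where
  open HasOrder ord

  mulS-shift : ∀ u t → mulS D u (t +ℕ s) ≡ sumTo t (λ r → D (r +ℕ s) * u (t ∸ r))
  mulS-shift u t = trans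
    (sumTo-dropZeros s t _ (λ i i<s → trans (cong (_* u (t +ℕ s ∸ i)) (below≡0 i i<s)) (*-zeroˡ (u (t +ℕ s ∸ i)))))
    (sumTo-cong t (λ r _ → cong (λ i → D (r +ℕ s) * u i)
      (trans (cong₂ _∸_ (ℕ.+-comm t s) (ℕ.+-comm r s)) (ℕ.[m+n]∸[m+o]≡n∸o s t r))))

  private
    Dₛ⁻¹ : ℚ
    Dₛ⁻¹ = invℚ (D s)

  quotS-correct-from : ∀ N t → mulS D (quotS s N D) (t +ℕ s) ≡ N (t +ℕ s)
  quotS-correct-from N zero = begin
    mulS D q s          ≡⟨ mulS-shift q 0 ⟩
    D s * (N s * Dₛ⁻¹)  ≡⟨ solve 3 (λ d a w → d :* (a :* w) := a :* (d :* w)) refl (D s) (N s) Dₛ⁻¹ ⟩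
    N s * (D s * Dₛ⁻¹)  ≡⟨ cong (N s *_) (invℚ-inverseʳ (D s) leading≢0) ⟩
    N s * 1ℚ            ≡⟨ *-identityʳ (N s) ⟩
    N s                 ∎
    where
    open ≡-Reasoning
    q : Series
    q = quotS s N D
  quotS-correct-from N (suc t) = begin
    mulS D q (suc t +ℕ s)                              ≡⟨ mulS-shift q (suc t) ⟩
    sumTo (suc t) (λ r → D (r +ℕ s) * q (suc t ∸ r))   ≡⟨ sumTo-sucˡ t _ ⟩
    D s * q (suc t) + tail                             ≡⟨ cong (λ z → D s * z + tail) q-suc ⟩
    D s * ((Nₜ - tail) * Dₛ⁻¹) + tail
      ≡⟨ solve 4 (λ d a c w → d :* ((a :- c) :* w) :+ c := (a :- c) :* (d :* w) :+ c) refl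
           (D s) Nₜ tail Dₛ⁻¹ ⟩
    (Nₜ - tail) * (D s * Dₛ⁻¹) + tail                  ≡⟨ cong (λ z → (Nₜ - tail) * z + tail)
                                                            (invℚ-inverseʳ (D s) leading≢0) ⟩
    (Nₜ - tail) * 1ℚ + tail                            ≡⟨ solve 2 (λ a c → (a :- c) :* con 1ℚ :+ c := a) refl Nₜ tail ⟩
    Nₜ                                                 ∎
    where
    open ≡-Reasoning
    q : Series
    q = quotS s N D
    Nₜ tail : ℚ
    Nₜ = N (suc t +ℕ s)
    tail = sumTo t (λ r → D (suc r +ℕ s) * q (t ∸ r))
    q-suc : q (suc t) ≡ (Nₜ - tail) * Dₛ⁻¹
    q-suc = trans (quotS-suc s N D t) (cong (λ z → (Nₜ - z) * Dₛ⁻¹) (quotConv-quotList s N D t t 1))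

  quotS-correct : ∀ N → (∀ i → i < s → N i ≡ 0ℚ) → mulS D (quotS s N D) ≗ N
  quotS-correct N N≡0 k with k ℕ.<? s
  ... | yes k<s = trans (sumTo-zero k _ (λ i i≤k → trans (cong (_* quotS s N D (k ∸ i))
                          (below≡0 i (ℕ.≤-<-trans i≤k k<s))) (*-zeroˡ (quotS s N D (k ∸ i)))))
                        (sym (N≡0 k k<s))
  ... | no  k≮s = subst (λ j → mulS D (quotS s N D) j ≡ N j) (ℕ.m∸n+n≡m (ℕ.≮⇒≥ k≮s))
                        (quotS-correct-from N (k ∸ s))

  mulS-zero⇒zero : ∀ u → (∀ k → mulS D u k ≡ 0ℚ) → ∀ k → u k ≡ 0ℚ
  mulS-zero⇒zero u Du≡0 = <-rec (λ k → u k ≡ 0ℚ) step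
    where
    step : ∀ k → (∀ {j} → j < k → u j ≡ 0ℚ) → u k ≡ 0ℚ
    step zero    _  = *-cancelˡ-≡0 (D s) (u 0) leading≢0 (trans (sym (mulS-shift u 0)) (Du≡0 s))
    step (suc k) ih = *-cancelˡ-≡0 (D s) (u (suc k)) leading≢0 (begin
      D s * u (suc k)                                          ≡⟨ +-identityʳ _ ⟨
      D s * u (suc k) + 0ℚ                                     ≡⟨ cong (D s * u (suc k) +_) tail≡0 ⟨
      D s * u (suc k) + sumTo k (λ r → D (suc r +ℕ s) * u (k ∸ r)) ≡⟨ sumTo-sucˡ k _ ⟨
      sumTo (suc k) (λ r → D (r +ℕ s) * u (suc k ∸ r))         ≡⟨ mulS-shift u (suc k) ⟨
      mulS D u (suc k +ℕ s)                                    ≡⟨ Du≡0 (suc k +ℕ s) ⟩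
      0ℚ                                                       ∎)
      where
      open ≡-Reasoning
      tail≡0 : sumTo k (λ r → D (suc r +ℕ s) * u (k ∸ r)) ≡ 0ℚ
      tail≡0 = sumTo-zero k _ (λ r _ →
        trans (cong (D (suc r +ℕ s) *_) (ih (ℕ.s≤s (ℕ.m∸n≤m k r)))) (*-zeroʳ (D (suc r +ℕ s))))

  mulS-cancelˡ : ∀ u v → mulS D u ≗ mulS D v → u ≗ v
  mulS-cancelˡ u v Du≗Dv k = begin
    u k                 ≡⟨ solve 2 (λ a b → a := (a :- b) :+ b) refl (u k) (v k) ⟩
    (u k - v k) + v k   ≡⟨ cong (_+ v k) (mulS-zero⇒zero (subS u v) D[u-v]≡0 k) ⟩
    0ℚ + v k            ≡⟨ +-identityˡ (v k) ⟩
    v k                 ∎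
    where
    open ≡-Reasoning
    D[u-v]≡0 : ∀ k → mulS D (subS u v) k ≡ 0ℚ
    D[u-v]≡0 k = trans (mulS-distribˡ-subS D u v k)
      (trans (cong (_- mulS D v k) (Du≗Dv k)) (+-inverseʳ (mulS D v k)))

  hb≗A[bQ−hP] : ∀ A P Q b h → mulS D b ≗ mulS A P → mulS (addS D oneS) h ≗ mulS A Q →
    mulS h b ≗ mulS A (subS (mulS b Q) (mulS h P))
  hb≗A[bQ−hP] A P Q b h Db≗AP D₁h≗AQ =
    mulS-cancelˡ (mulS h b) (mulS A R) (λ k → trans (D[hb] k) (sym (D[AR] k)))
    where
    R : Series
    R = subS (mulS b Q) (mulS h P)

    Dh≗AQ−h : mulS D h ≗ subS (mulS A Q) h
    Dh≗AQ−h k = begin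
      mulS D h k                        ≡⟨ solve 2 (λ a c → a := a :+ c :- c) refl (mulS D h k) (h k) ⟩
      mulS D h k + h k - h k            ≡⟨ cong (λ z → mulS D h k + z - h k) (mulS-identityˡ h k) ⟨
      mulS D h k + mulS oneS h k - h k  ≡⟨ cong (_- h k) (mulS-distribʳ-addS D oneS h k) ⟨
      mulS (addS D oneS) h k - h k      ≡⟨ cong (_- h k) (D₁h≗AQ k) ⟩
      mulS A Q k - h k                  ∎
      where open ≡-Reasoning

    APQ≗AQP : mulS (mulS A P) Q ≗ mulS (mulS A Q) P
    APQ≗AQP = begin
      mulS (mulS A P) Q  ≈⟨ mulS-assoc A P Q ⟩
      mulS A (mulS P Q)  ≈⟨ mulS-congʳ A (mulS-comm P Q) ⟩
      mulS A (mulS Q P)  ≈⟨ mulS-assoc A Q P ⟨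
      mulS (mulS A Q) P  ∎
      where open ≗-Reasoning

    DR≗hP : mulS D R ≗ mulS h P
    DR≗hP k = begin
      mulS D R k
        ≡⟨ mulS-distribˡ-subS D (mulS b Q) (mulS h P) k ⟩
      mulS D (mulS b Q) k - mulS D (mulS h P) k
        ≡⟨ cong₂ _-_ (mulS-assoc D b Q k) (mulS-assoc D h P k) ⟨
      mulS (mulS D b) Q k - mulS (mulS D h) P k
        ≡⟨ cong₂ _-_ (trans (mulS-congˡ Q Db≗AP k) (APQ≗AQP k))
                     (trans (mulS-congˡ P Dh≗AQ−h k) (mulS-distribʳ-subS (mulS A Q) h P k)) ⟩
      mulS (mulS A Q) P k - (mulS (mulS A Q) P k - mulS h P k)
        ≡⟨ solve 2 (λ a c → a :- (a :- c) := c) refl (mulS (mulS A Q) P k) (mulS h P k) ⟩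
      mulS h P k
        ∎
      where open ≡-Reasoning

    D[hb] : mulS D (mulS h b) ≗ mulS h (mulS A P)
    D[hb] = begin
      mulS D (mulS h b)  ≈⟨ mulS-swap D h b ⟩
      mulS h (mulS D b)  ≈⟨ mulS-congʳ h Db≗AP ⟩
      mulS h (mulS A P)  ∎
      where open ≗-Reasoning

    D[AR] : mulS D (mulS A R) ≗ mulS h (mulS A P)
    D[AR] = begin
      mulS D (mulS A R)  ≈⟨ mulS-swap D A R ⟩
      mulS A (mulS D R)  ≈⟨ mulS-congʳ A DR≗hP ⟩
      mulS A (mulS h P)  ≈⟨ mulS-swap A h P ⟩
      mulS h (mulS A P)  ∎
      where open ≗-Reasoning

ℕ→ℚ≡mkℚ : ∀ n → ℕ→ℚ n ≡ mkℚ (ℤ.+ n) 0 (coprime-sym (1-coprimeTo n))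
ℕ→ℚ≡mkℚ n = normalize-coprime (coprime-sym (1-coprimeTo n))

ℕ→ℚ-* : ∀ a b → ℕ→ℚ a * ℕ→ℚ b ≡ ℕ→ℚ (a ℕ.* b)
ℕ→ℚ-* a b = trans (cong₂ _*_ (ℕ→ℚ≡mkℚ a) (ℕ→ℚ≡mkℚ b)) (cong (_/ 1) (sym (pos-* a b)))

ℕ→ℚ-*-inverseʳ : ∀ d .{{_ : NonZero d}} → ℕ→ℚ d * (ℤ.+ 1 / d) ≡ 1ℚ
ℕ→ℚ-*-inverseʳ (suc d) = trans
  (cong₂ _*_ (ℕ→ℚ≡mkℚ (suc d)) (normalize-coprime (1-coprimeTo (suc d))))
  (*-inverseʳ (mkℚ (ℤ.+ suc d) 0 (coprime-sym (1-coprimeTo (suc d)))))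

!*inv!≡1 : ∀ k → ℕ→ℚ (k !) * inv! k ≡ 1ℚ
!*inv!≡1 k = ℕ→ℚ-*-inverseʳ (k !) {{k ℕ.!≢0}}

inv!≢0 : ∀ k → inv! k ≢ 0ℚ
inv!≢0 k inv!≡0 with trans (sym (!*inv!≡1 k)) (trans (cong (ℕ→ℚ (k !) *_) inv!≡0) (*-zeroʳ (ℕ→ℚ (k !))))
... | ()

C*!*!≡! : ∀ {n j} → j ≤ n → ℕ→ℚ (n C j) * ℕ→ℚ (j !) * ℕ→ℚ ((n ∸ j) !) ≡ ℕ→ℚ (n !)
C*!*!≡! {n} {j} j≤n = begin
  ℕ→ℚ (n C j) * ℕ→ℚ (j !) * ℕ→ℚ ((n ∸ j) !)  ≡⟨ *-assoc (ℕ→ℚ (n C j)) _ _ ⟩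
  ℕ→ℚ (n C j) * (ℕ→ℚ (j !) * ℕ→ℚ ((n ∸ j) !))  ≡⟨ cong (ℕ→ℚ (n C j) *_) (ℕ→ℚ-* (j !) ((n ∸ j) !)) ⟩
  ℕ→ℚ (n C j) * ℕ→ℚ (j ! ℕ.* (n ∸ j) !)        ≡⟨ ℕ→ℚ-* (n C j) _ ⟩
  ℕ→ℚ ((n C j) ℕ.* (j ! ℕ.* (n ∸ j) !))        ≡⟨ cong ℕ→ℚ C*!*!≡!ℕ ⟩
  ℕ→ℚ (n !)                                    ∎
  where
  open ≡-Reasoning
  C*!*!≡!ℕ : (n C j) ℕ.* (j ! ℕ.* (n ∸ j) !) ≡ n !
  C*!*!≡!ℕ = trans (cong (ℕ._* (j ! ℕ.* (n ∸ j) !)) (nCk≡n!/k![n-k]! j≤n))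
                   (m/n*n≡m {{j ℕ.!* (n ∸ j) !≢0}} (k![n∸k]!∣n! j≤n))

pow≡!*expS : ∀ x k → pow x k ≡ ℕ→ℚ (k !) * expS x k
pow≡!*expS x k = begin
  pow x k                              ≡⟨ *-identityʳ (pow x k) ⟨
  pow x k * 1ℚ                         ≡⟨ cong (pow x k *_) (!*inv!≡1 k) ⟨
  pow x k * (ℕ→ℚ (k !) * inv! k)       ≡⟨ solve 3 (λ p f i → p :* (f :* i) := f :* (p :* i)) refl
                                            (pow x k) (ℕ→ℚ (k !)) (inv! k) ⟩
  ℕ→ℚ (k !) * (pow x k * inv! k)       ∎
  where open ≡-Reasoning

binomial-convolution : ∀ n (u v : Series) →
  sumTo n (λ j → ℕ→ℚ (n C j) * (ℕ→ℚ (j !) * u j) * (ℕ→ℚ ((n ∸ j) !) * v (n ∸ j)))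
  ≡ ℕ→ℚ (n !) * mulS u v n
binomial-convolution n u v =
  trans (sumTo-cong n term) (sym (*-distribˡ-sumTo n (ℕ→ℚ (n !)) (λ j → u j * v (n ∸ j))))
  where
  term : ∀ j → j ≤ n → ℕ→ℚ (n C j) * (ℕ→ℚ (j !) * u j) * (ℕ→ℚ ((n ∸ j) !) * v (n ∸ j))
                       ≡ ℕ→ℚ (n !) * (u j * v (n ∸ j))
  term j j≤n = trans
    (solve 5 (λ c a f p q → c :* (a :* p) :* (f :* q) := (c :* a :* f) :* (p :* q)) refl
       (ℕ→ℚ (n C j)) (ℕ→ℚ (j !)) (ℕ→ℚ ((n ∸ j) !)) (u j) (v (n ∸ j)))
    (cong (_* (u j * v (n ∸ j))) (C*!*!≡! j≤n))

pow-1ℚ : ∀ k → pow 1ℚ k ≡ 1ℚ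
pow-1ℚ zero    = refl
pow-1ℚ (suc k) = cong (1ℚ *_) (pow-1ℚ k)

expS-1ℚ : ∀ k → expS 1ℚ k ≡ inv! k
expS-1ℚ k = trans (cong (_* inv! k) (pow-1ℚ k)) (*-identityˡ (inv! k))

truncS-< : ∀ m i → i < m → truncS m i ≡ inv! i
truncS-< m i i<m with i <ᵇ m in eq
... | true  = refl
... | false = ⊥-elim (subst T eq (ℕ.<⇒<ᵇ i<m))

truncS-≮ : ∀ m i → ¬ (i < m) → truncS m i ≡ 0ℚ
truncS-≮ m i i≮m with i <ᵇ m in eq
... | true  = ⊥-elim (i≮m (ℕ.<ᵇ⇒< i m (subst T (sym eq) _)))
... | false = refl

monoS-≢ : ∀ m j → j ≢ m → monoS m j ≡ 0ℚ
monoS-≢ m j j≢m with j ≡ᵇ m in eq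
... | true  = ⊥-elim (j≢m (ℕ.≡ᵇ⇒≡ j m (subst T (sym eq) _)))
... | false = refl

monoS-diag : ∀ m → monoS m m ≡ inv! m
monoS-diag m with m ≡ᵇ m in eq
... | true  = refl
... | false = ⊥-elim (subst T eq (ℕ.≡⇒≡ᵇ m m refl))

denB-hasOrder : ∀ m → HasOrder m (denB m)
denB-hasOrder m = record { leading≢0 = leading≢0 ; below≡0 = below≡0 }
  where
  leading≢0 : denB m m ≢ 0ℚ
  leading≢0 denBₘ≡0 = inv!≢0 m (begin
    inv! m             ≡⟨ +-identityʳ (inv! m) ⟨
    inv! m - 0ℚ        ≡⟨ cong₂ _-_ (expS-1ℚ m) (truncS-≮ m m (ℕ.<-irrefl refl)) ⟨
    denB m m           ≡⟨ denBₘ≡0 ⟩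
    0ℚ                 ∎)
    where open ≡-Reasoning
  below≡0 : ∀ i → i < m → denB m i ≡ 0ℚ
  below≡0 i i<m = trans (cong₂ _-_ (expS-1ℚ i) (truncS-< m i i<m)) (+-inverseʳ (inv! i))

denE-hasOrder : ∀ m → HasOrder 0 (denE m)
denE-hasOrder m = record { leading≢0 = denE₀≢0 m ; below≡0 = λ i () }
  where
  denE₀≢0 : ∀ m → denE m 0 ≢ 0ℚ
  denE₀≢0 zero    ()
  denE₀≢0 (suc m) ()

denE≗denB+1 : ∀ m → denE m ≗ addS (denB m) oneS
denE≗denB+1 m k =
  solve 3 (λ a o t → a :+ o :- t := (a :- t) :+ o) refl (expS 1ℚ k) (oneS k) (truncS m k)

numB-below : ∀ m x i → i < m → numB m x i ≡ 0ℚ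
numB-below m x i i<m = sumTo-zero i _ (λ j j≤i →
  trans (cong (_* expS x (i ∸ j)) (monoS-≢ m j (λ { refl → ℕ.<-irrefl refl (ℕ.≤-<-trans j≤i i<m) })))
        (*-zeroˡ (expS x (i ∸ j))))

-- bSeries m x y j = B m j x / j!  and  hSeries m x y j = ½ E m j y / j!.
module _ (m : ℕ) (x y : ℚ) where

  bSeries hSeries : Series
  bSeries = quotS m (numB m x) (denB m)
  hSeries = scaleS ½ (quotS 0 (numE m y) (denE m))

  denB-bSeries : mulS (denB m) bSeries ≗ mulS (monoS m) (expS x)
  denB-bSeries = quotS-correct (denB-hasOrder m) (numB m x) (numB-below m x)

  denB+1-hSeries : mulS (addS (denB m) oneS) hSeries ≗ mulS (monoS m) (expS y)
  denB+1-hSeries k = begin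
    mulS (addS (denB m) oneS) hSeries k  ≡⟨ mulS-congˡ hSeries (denE≗denB+1 m) k ⟨
    mulS (denE m) hSeries k              ≡⟨ mulS-scaleʳ ½ (denE m) e k ⟩
    ½ * mulS (denE m) e k                ≡⟨ cong (½ *_) (quotS-correct (denE-hasOrder m) (numE m y) (λ i ()) k) ⟩
    ½ * (ℕ→ℚ 2 * mulS (monoS m) (expS y) k)
      ≡⟨ solve 1 (λ a → con ½ :* (con (ℕ→ℚ 2) :* a) := a) refl (mulS (monoS m) (expS y) k) ⟩
    mulS (monoS m) (expS y) k            ∎
    where
    open ≡-Reasoning
    e : Series
    e = quotS 0 (numE m y) (denE m)

  hb≗M[bY−hX] : mulS hSeries bSeries ≗
    mulS (monoS m) (subS (mulS bSeries (expS y)) (mulS hSeries (expS x)))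
  hb≗M[bY−hX] = hb≗A[bQ−hP] (denB-hasOrder m) (monoS m) (expS x) (expS y) bSeries hSeries
    denB-bSeries denB+1-hSeries

  bY−hX : Series
  bY−hX = subS (mulS bSeries (expS y)) (mulS hSeries (expS x))

  binomial-sum≡!*bY−hX : ∀ n →
    sumTo n (λ j → ℕ→ℚ (n C j) * (B m j x * pow y (n ∸ j) - ½ * E m j y * pow x (n ∸ j)))
    ≡ ℕ→ℚ (n !) * bY−hX n
  binomial-sum≡!*bY−hX n = begin
    sumTo n (λ j → ℕ→ℚ (n C j) * (B m j x * pow y (n ∸ j) - ½ * E m j y * pow x (n ∸ j)))
      ≡⟨ sumTo-cong n (λ j _ → term j) ⟩
    sumTo n (λ j → bY-term j - hX-term j)
      ≡⟨ sumTo-sub n bY-term hX-term ⟩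
    sumTo n bY-term - sumTo n hX-term
      ≡⟨ cong₂ _-_ (binomial-convolution n bSeries (expS y)) (binomial-convolution n hSeries (expS x)) ⟩
    ℕ→ℚ (n !) * mulS bSeries (expS y) n - ℕ→ℚ (n !) * mulS hSeries (expS x) n
      ≡⟨ solve 3 (λ f a c → f :* a :- f :* c := f :* (a :- c)) refl
           (ℕ→ℚ (n !)) (mulS bSeries (expS y) n) (mulS hSeries (expS x) n) ⟩
    ℕ→ℚ (n !) * bY−hX n
      ∎
    where
    open ≡-Reasoning
    bY-term hX-term : ℕ → ℚ
    bY-term j = ℕ→ℚ (n C j) * (ℕ→ℚ (j !) * bSeries j) * (ℕ→ℚ ((n ∸ j) !) * expS y (n ∸ j))
    hX-term j = ℕ→ℚ (n C j) * (ℕ→ℚ (j !) * hSeries j) * (ℕ→ℚ ((n ∸ j) !) * expS x (n ∸ j))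

    term : ∀ j → ℕ→ℚ (n C j) * (B m j x * pow y (n ∸ j) - ½ * E m j y * pow x (n ∸ j))
                 ≡ bY-term j - hX-term j
    term j = trans
      (cong₂ (λ p q → c * (B m j x * p - ½ * E m j y * q)) (pow≡!*expS y (n ∸ j)) (pow≡!*expS x (n ∸ j)))
      (solve 8 (λ c f g b e Y X h → c :* (f :* b :* (g :* Y) :- h :* (f :* e) :* (g :* X))
                                  := c :* (f :* b) :* (g :* Y) :- c :* (f :* (h :* e)) :* (g :* X))
         refl c (ℕ→ℚ (j !)) (ℕ→ℚ ((n ∸ j) !)) (bSeries j) (quotS 0 (numE m y) (denE m) j)
         (expS y (n ∸ j)) (expS x (n ∸ j)) ½)
      where
      c : ℚ
      c = ℕ→ℚ (n C j)

C*!≡!*inv! : ∀ n m → ℕ→ℚ ((n +ℕ m) C n) * ℕ→ℚ (n !) ≡ ℕ→ℚ ((n +ℕ m) !) * inv! m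
C*!≡!*inv! n m = begin
  ℕ→ℚ (N C n) * ℕ→ℚ (n !)                            ≡⟨ *-identityʳ _ ⟨
  ℕ→ℚ (N C n) * ℕ→ℚ (n !) * 1ℚ                       ≡⟨ cong (ℕ→ℚ (N C n) * ℕ→ℚ (n !) *_) (!*inv!≡1 m) ⟨
  ℕ→ℚ (N C n) * ℕ→ℚ (n !) * (ℕ→ℚ (m !) * inv! m)     ≡⟨ *-assoc (ℕ→ℚ (N C n) * ℕ→ℚ (n !)) _ _ ⟨
  ℕ→ℚ (N C n) * ℕ→ℚ (n !) * ℕ→ℚ (m !) * inv! m       ≡⟨ cong (λ k → ℕ→ℚ (N C n) * ℕ→ℚ (n !) * ℕ→ℚ (k !) * inv! m)
                                                          (ℕ.m+n∸m≡n n m) ⟨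
  ℕ→ℚ (N C n) * ℕ→ℚ (n !) * ℕ→ℚ ((N ∸ n) !) * inv! m ≡⟨ cong (_* inv! m) (C*!*!≡! (ℕ.m≤m+n n m)) ⟩
  ℕ→ℚ (N !) * inv! m                                 ∎
  where
  open ≡-Reasoning
  N : ℕ
  N = n +ℕ m

mainTheorem8 : (n m : ℕ) (x y : ℚ) →
    ℕ→ℚ ((n +ℕ m) C n)
      * sumTo n (λ j → ℕ→ℚ (n C j)
          * (B m j x * pow y (n ∸ j) - ½ * E m j y * pow x (n ∸ j)))
    ≡ ½ * sumTo (n +ℕ m) (λ j → ℕ→ℚ ((n +ℕ m) C j) * E m j y * B m (n +ℕ m ∸ j) x)
mainTheorem8 n m x y = begin
  ℕ→ℚ (N C n) * sumTo n (λ j → ℕ→ℚ (n C j) * (B m j x * pow y (n ∸ j) - ½ * E m j y * pow x (n ∸ j)))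
    ≡⟨ cong (ℕ→ℚ (N C n) *_) (binomial-sum≡!*bY−hX m x y n) ⟩
  ℕ→ℚ (N C n) * (ℕ→ℚ (n !) * R n)
    ≡⟨ *-assoc (ℕ→ℚ (N C n)) (ℕ→ℚ (n !)) (R n) ⟨
  ℕ→ℚ (N C n) * ℕ→ℚ (n !) * R n
    ≡⟨ trans (cong (_* R n) (C*!≡!*inv! n m)) (*-assoc (ℕ→ℚ (N !)) (inv! m) (R n)) ⟩
  ℕ→ℚ (N !) * (inv! m * R n)
    ≡⟨ cong (ℕ→ℚ (N !) *_) (trans (mulS-single (monoS m) R m (monoS-≢ m) n)
                                  (cong (_* R n) (monoS-diag m))) ⟨
  ℕ→ℚ (N !) * mulS (monoS m) R N
    ≡⟨ cong (ℕ→ℚ (N !) *_) (hb≗M[bY−hX] m x y N) ⟨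
  ℕ→ℚ (N !) * mulS (hSeries m x y) b N
    ≡⟨ cong (ℕ→ℚ (N !) *_) (mulS-scaleˡ ½ e b N) ⟩
  ℕ→ℚ (N !) * (½ * mulS e b N)
    ≡⟨ solve 2 (λ f c → f :* (con ½ :* c) := con ½ :* (f :* c)) refl (ℕ→ℚ (N !)) (mulS e b N) ⟩
  ½ * (ℕ→ℚ (N !) * mulS e b N)
    ≡⟨ cong (½ *_) (binomial-convolution N e b) ⟨
  ½ * sumTo N (λ j → ℕ→ℚ (N C j) * E m j y * B m (N ∸ j) x)
    ∎
  where
  open ≡-Reasoning
  N : ℕ
  N = n +ℕ m
  R b e : Series
  R = bY−hX m x y
  b = bSeries m x y
  e = quotS 0 (numE m y) (denE m)
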